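{- For every nonnegative integer $k$ and positive integer $M$, $|F(k,M)| = O(M\log k)$.
   Context: For a nonnegative integer $k$ and a positive integer $M$, the set of nonnegative integers $F(k,M)$ is defined recursively by $F(k,M)=\{0,\ldots,k\}$ if $k\le M+1$, and $F(k,M)=\{k\}\cup\bigcup_{i=\lfloor (k-M)/2\rfloor}^{\lceil (k+M)/2\rceil}F(i,M)$ if $k>M+1$. -}

module Defs where

open import Data.Nat using (ℕ; zero; suc; _+_; _∸_; _≤?_; ⌊_/2⌋; ⌈_/2⌉)
open import Data.Nat.Properties using (_≟_)
open import Data.List using (List; []; _∷_; upTo; map; concatMap; deduplicate; length)
open import Relation.Nullary using (yes; no)

-- The integer interval [lo, hi] as a list (empty if hi < lo).
range : ℕ → ℕ → List ℕ
range lo hi = map (lo +_) (upTo (suc hi ∸ lo))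

-- F with explicit recursion depth (fuel).  Whenever k > M+1 the recursive
-- calls are on i ≤ ⌈(k+M)/2⌉ < k, so fuel suc k always suffices to unfold
-- the paper's recursion completely.
Fᶠ : ℕ → ℕ → ℕ → List ℕ
Fᶠ zero       k M = []
Fᶠ (suc fuel) k M with k ≤? suc M
... | yes _ = upTo (suc k)
... | no  _ = k ∷ concatMap (λ i → Fᶠ fuel i M)
                   (range ⌊ k ∸ M /2⌋ ⌈ k + M /2⌉)

F : ℕ → ℕ → List ℕ
F k M = Fᶠ (suc k) k M

card-F : ℕ → ℕ → ℕ
card-F k M = length (deduplicate _≟_ (F k M))

-- Unfolding the recursion d times from k, every argument reached stays within distance M+1
-- of ⌊k/2^d⌋: if |x − q| ≤ M+1, every i in [⌊(x−M)/2⌋, ⌈(x+M)/2⌉] satisfies |i − ⌊q/2⌋| ≤ M+1.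
-- An argument x > M+1 forces ⌊k/2^d⌋ ≥ 1, i.e. d ≤ ⌊log₂ k⌋, and arguments x ≤ M+1 only
-- contribute {0,…,M+1}. So F(k,M) lies in {0,…,M+1} together with ⌊log₂ k⌋+1 windows of
-- 2M+3 consecutive integers.
module Submission where

open import Defs
open import Data.Nat using (ℕ; _*_; _≤_)
open import Data.Nat.Logarithm using (⌊log₂_⌋)
open import Data.Product using (∃-syntax)

open import Data.Nat using (zero; suc; _+_; _∸_; _^_; _<_; _≤?_; ⌊_/2⌋; ⌈_/2⌉; z≤n; s≤s; s≤s⁻¹)
open import Data.Nat.Properties
open import Data.Nat.Logarithm using (⌊log₂⌋-mono-≤; ⌊log₂[2^n]⌋≡n)
open import Data.Nat.Solver using (module +-*-Solver)
open import Data.Fin using (Fin; zero; suc)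
open import Data.Fin.Properties using (injective⇒≤)
open import Data.Product using (_,_; _×_)
open import Data.Empty using (⊥-elim)
open import Function using (_∘_)
open import Data.List using (List; []; _∷_; _++_; length; lookup; upTo; concatMap)
open import Data.List.Properties using (length-++; length-map; length-upTo)
open import Data.List.Membership.Propositional using (_∈_; find; lose)
open import Data.List.Membership.Propositional.Properties
  using (∈-lookup; ∈-map⁺; ∈-map⁻; ∈-upTo⁺; ∈-upTo⁻; ∈-++⁺ˡ; ∈-++⁺ʳ;
         ∈-concatMap⁺; ∈-concatMap⁻; ∈-deduplicate⁻)
open import Data.List.Membership.Setoid.Properties using (index-injective)
open import Data.List.Relation.Binary.Subset.Propositional using (_⊆_)
open import Data.List.Relation.Unary.Any using (here; there)
import Data.List.Relation.Unary.All as All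
open import Data.List.Relation.Unary.AllPairs using (_∷_)
open import Data.List.Relation.Unary.Unique.Propositional using (Unique)
open import Data.List.Relation.Unary.Unique.DecPropositional.Properties _≟_ using (deduplicate-!)
open import Relation.Binary.PropositionalEquality
open import Relation.Nullary using (yes; no)

open +-*-Solver

lookup-injective : ∀ {A : Set} {xs : List A} → Unique xs → ∀ {i j} → lookup xs i ≡ lookup xs j → i ≡ j
lookup-injective (x∉xs ∷ u) {zero}  {zero}  eq = refl
lookup-injective (x∉xs ∷ u) {zero}  {suc j} eq = ⊥-elim (All.lookup x∉xs (∈-lookup j) eq)
lookup-injective (x∉xs ∷ u) {suc i} {zero}  eq = ⊥-elim (All.lookup x∉xs (∈-lookup i) (sym eq))
lookup-injective (x∉xs ∷ u) {suc i} {suc j} eq = cong suc (lookup-injective u eq)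

unique∧⊆⇒length-≤ : ∀ {A : Set} {xs ys : List A} → Unique xs → xs ⊆ ys → length xs ≤ length ys
unique∧⊆⇒length-≤ {A} {xs} u xs⊆ys = injective⇒≤ {f = position} position-injective
  where
  position : Fin (length xs) → Fin _
  position i = Data.List.Relation.Unary.Any.index (xs⊆ys (∈-lookup i))

  position-injective : ∀ {i j} → position i ≡ position j → i ≡ j
  position-injective {i} {j} eq =
    lookup-injective u (index-injective (setoid A) (xs⊆ys (∈-lookup i)) (xs⊆ys (∈-lookup j)) eq)

length-concatMap-≤ : ∀ {A B : Set} (f : A → List B) {b} → (∀ x → length (f x) ≤ b) →
                     ∀ xs → length (concatMap f xs) ≤ length xs * b
length-concatMap-≤ f f≤b []       = z≤n
length-concatMap-≤ f f≤b (x ∷ xs) =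
  ≤-trans (≤-reflexive (length-++ (f x))) (+-mono-≤ (f≤b x) (length-concatMap-≤ f f≤b xs))

∈-range⁻ : ∀ {a b i} → i ∈ range a b → a ≤ i × i ≤ b
∈-range⁻ {a} {b} p with j , j∈upTo , refl ← ∈-map⁻ (a +_) p = m≤m+n a j , a+j≤b
  where
  j<b+1∸a : j < suc b ∸ a
  j<b+1∸a = ∈-upTo⁻ j∈upTo

  a≤b+1 : a ≤ suc b
  a≤b+1 = <⇒≤ (m∸n≢0⇒n<m λ b+1∸a≡0 → n≮0 (subst (j <_) b+1∸a≡0 j<b+1∸a))

  a+j≤b : a + j ≤ b
  a+j≤b = s≤s⁻¹ (subst (_≤ suc b) (trans (+-comm (suc j) a) (+-suc a j))
                        (m≤o∸n⇒m+n≤o (suc j) a≤b+1 j<b+1∸a))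

∈-range⁺ : ∀ {a b i} → a ≤ i → i ≤ b → i ∈ range a b
∈-range⁺ {a} {b} a≤i i≤b =
  subst (_∈ range a b) (m+[n∸m]≡n a≤i) (∈-map⁺ (a +_) (∈-upTo⁺ (∸-monoˡ-< (s≤s i≤b) a≤i)))

length-range : ∀ a b → length (range a b) ≡ suc b ∸ a
length-range a b = trans (length-map (a +_) (upTo (suc b ∸ a))) (length-upTo (suc b ∸ a))

Within : ℕ → ℕ → ℕ → Set
Within r x y = x ≤ r + y × y ≤ r + x

window : ℕ → ℕ → List ℕ
window r q = range (q ∸ r) (r + q)

∈-window : ∀ {r q y} → Within r q y → y ∈ window r q
∈-window {r} {q} (q≤r+y , y≤r+q) = ∈-range⁺ (m≤n+o⇒m∸n≤o q r q≤r+y) y≤r+q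

length-window : ∀ r q → length (window r q) ≤ suc (r + r)
length-window r q = begin
  length (window r q)     ≡⟨ length-range (q ∸ r) (r + q) ⟩
  suc (r + q) ∸ (q ∸ r)   ≤⟨ m≤n+o⇒m∸n≤o (suc (r + q)) (q ∸ r) r+q<[q∸r]+2r+1 ⟩
  suc (r + r)             ∎
  where
  open ≤-Reasoning
  r+q<[q∸r]+2r+1 : suc (r + q) ≤ (q ∸ r) + suc (r + r)
  r+q<[q∸r]+2r+1 = ≤-trans (s≤s (+-monoʳ-≤ r (m≤n+m∸n q r)))
    (≤-reflexive (solve 2 (λ r e → con 1 :+ (r :+ (r :+ e)) := e :+ (con 1 :+ (r :+ r))) refl r (q ∸ r)))

⌊_/2^_⌋ : ℕ → ℕ → ℕ
⌊ n /2^ zero  ⌋ = n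
⌊ n /2^ suc d ⌋ = ⌊ ⌊ n /2^ d ⌋ /2⌋

2*⌊n/2⌋≤n : ∀ n → 2 * ⌊ n /2⌋ ≤ n
2*⌊n/2⌋≤n n = ≤-trans (+-monoʳ-≤ ⌊ n /2⌋ (≤-trans (≤-reflexive (+-identityʳ _)) (⌊n/2⌋≤⌈n/2⌉ n)))
                      (≤-reflexive (⌊n/2⌋+⌈n/2⌉≡n n))

2^d*⌊n/2^d⌋≤n : ∀ d n → 2 ^ d * ⌊ n /2^ d ⌋ ≤ n
2^d*⌊n/2^d⌋≤n zero    n = ≤-reflexive (+-identityʳ n)
2^d*⌊n/2^d⌋≤n (suc d) n = begin
  2 * 2 ^ d * ⌊ q /2⌋     ≡⟨ cong (_* ⌊ q /2⌋) (*-comm 2 (2 ^ d)) ⟩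
  2 ^ d * 2 * ⌊ q /2⌋     ≡⟨ *-assoc (2 ^ d) 2 ⌊ q /2⌋ ⟩
  2 ^ d * (2 * ⌊ q /2⌋)   ≤⟨ *-monoʳ-≤ (2 ^ d) (2*⌊n/2⌋≤n q) ⟩
  2 ^ d * q               ≤⟨ 2^d*⌊n/2^d⌋≤n d n ⟩
  n                       ∎
  where
  open ≤-Reasoning
  q : ℕ
  q = ⌊ n /2^ d ⌋

⌊n/2^d⌋>0⇒d≤⌊log₂n⌋ : ∀ d n → 1 ≤ ⌊ n /2^ d ⌋ → d ≤ ⌊log₂ n ⌋
⌊n/2^d⌋>0⇒d≤⌊log₂n⌋ d n q>0 = begin
  d                  ≡⟨ ⌊log₂[2^n]⌋≡n d ⟨
  ⌊log₂ (2 ^ d) ⌋    ≤⟨ ⌊log₂⌋-mono-≤ 2^d≤n ⟩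
  ⌊log₂ n ⌋          ∎
  where
  open ≤-Reasoning
  2^d≤n : 2 ^ d ≤ n
  2^d≤n = begin
    2 ^ d                ≡⟨ *-identityʳ (2 ^ d) ⟨
    2 ^ d * 1            ≤⟨ *-monoʳ-≤ (2 ^ d) q>0 ⟩
    2 ^ d * ⌊ n /2^ d ⌋  ≤⟨ 2^d*⌊n/2^d⌋≤n d n ⟩
    n                    ∎

⌊m+m+n/2⌋≡m+⌊n/2⌋ : ∀ m n → ⌊ m + m + n /2⌋ ≡ m + ⌊ n /2⌋
⌊m+m+n/2⌋≡m+⌊n/2⌋ zero    n = refl
⌊m+m+n/2⌋≡m+⌊n/2⌋ (suc m) n =
  trans (cong (λ t → ⌊ suc t + n /2⌋) (+-suc m m)) (cong suc (⌊m+m+n/2⌋≡m+⌊n/2⌋ m n))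

within-halve : ∀ M {q x i} → Within (suc M) q x → i ∈ range ⌊ x ∸ M /2⌋ ⌈ x + M /2⌉ →
               Within (suc M) ⌊ q /2⌋ i
within-halve M {q} {x} {i} (q≤M+1+x , x≤M+1+q) i∈range
  with ⌊x∸M/2⌋≤i , i≤⌈x+M/2⌉ ← ∈-range⁻ i∈range = ⌊q/2⌋≤M+1+i , i≤M+1+⌊q/2⌋
  where
  halve-shifted : ∀ {n} → n ≤ suc M + suc M + q → ⌊ n /2⌋ ≤ suc M + ⌊ q /2⌋
  halve-shifted n≤ = ≤-trans (⌊n/2⌋-mono n≤) (≤-reflexive (⌊m+m+n/2⌋≡m+⌊n/2⌋ (suc M) q))

  i≤M+1+⌊q/2⌋ : i ≤ suc M + ⌊ q /2⌋
  i≤M+1+⌊q/2⌋ = ≤-trans i≤⌈x+M/2⌉ (halve-shifted (≤-trans (s≤s (+-monoˡ-≤ M x≤M+1+q))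
    (≤-reflexive (solve 2 (λ m q → con 1 :+ ((con 1 :+ m :+ q) :+ m)
                                  := (con 1 :+ m) :+ (con 1 :+ m) :+ q) refl M q))))

  q≤2M+2+[x∸M] : q ≤ suc M + suc M + (x ∸ M)
  q≤2M+2+[x∸M] = ≤-trans q≤M+1+x (≤-trans (+-monoʳ-≤ (suc M) (≤-trans (m≤n+m∸n x M) (n≤1+n _)))
    (≤-reflexive (sym (+-assoc (suc M) (suc M) (x ∸ M)))))

  ⌊q/2⌋≤M+1+i : ⌊ q /2⌋ ≤ suc M + i
  ⌊q/2⌋≤M+1+i = ≤-trans (⌊n/2⌋-mono q≤2M+2+[x∸M]) (≤-trans
    (≤-reflexive (⌊m+m+n/2⌋≡m+⌊n/2⌋ (suc M) (x ∸ M))) (+-monoʳ-≤ (suc M) ⌊x∸M/2⌋≤i))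

module _ (k M : ℕ) where

  window-at : ℕ → List ℕ
  window-at d = window (suc M) ⌊ k /2^ d ⌋

  cover : List ℕ
  cover = upTo (suc (suc M)) ++ concatMap window-at (upTo (suc ⌊log₂ k ⌋))

  window⊆cover : ∀ {d} → d ≤ ⌊log₂ k ⌋ → window-at d ⊆ cover
  window⊆cover d≤log y∈window =
    ∈-++⁺ʳ (upTo (suc (suc M)))
      (∈-concatMap⁺ window-at (lose (∈-upTo⁺ (s≤s d≤log)) y∈window))

  Fᶠ⊆cover : ∀ fuel d {x} → Within (suc M) ⌊ k /2^ d ⌋ x → Fᶠ fuel x M ⊆ cover
  Fᶠ⊆cover zero       d near ()
  Fᶠ⊆cover (suc fuel) d {x} near y∈F with x ≤? suc M
  ... | yes x≤M+1 = ∈-++⁺ˡ (∈-upTo⁺ (s≤s (≤-trans (s≤s⁻¹ (∈-upTo⁻ y∈F)) x≤M+1)))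
  Fᶠ⊆cover (suc fuel) d near@(_ , x≤M+1+q) (here refl) | no x≰M+1 =
    window⊆cover (⌊n/2^d⌋>0⇒d≤⌊log₂n⌋ d k q>0) (∈-window near)
    where
    q>0 : 1 ≤ ⌊ k /2^ d ⌋
    q>0 = +-cancelˡ-≤ (suc M) 1 ⌊ k /2^ d ⌋
            (subst (_≤ suc M + ⌊ k /2^ d ⌋) (+-comm 1 (suc M)) (≤-trans (≰⇒> x≰M+1) x≤M+1+q))
  Fᶠ⊆cover (suc fuel) d {x} near (there y∈⋃) | no _
    with i , i∈range , y∈Fi ←
           find (∈-concatMap⁻ (λ i → Fᶠ fuel i M) {xs = range ⌊ x ∸ M /2⌋ ⌈ x + M /2⌉} y∈⋃)
    = Fᶠ⊆cover fuel (suc d) (within-halve M near i∈range) y∈Fi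

  F⊆cover : F k M ⊆ cover
  F⊆cover = Fᶠ⊆cover (suc k) 0 (m≤n+m k (suc M) , m≤n+m k (suc M))

  length-cover : length cover ≤ suc (suc M) + suc ⌊log₂ k ⌋ * suc (suc M + suc M)
  length-cover = begin
    length cover                                         ≡⟨ length-++ (upTo (suc (suc M))) ⟩
    length (upTo (suc (suc M))) + length (concatMap window-at ds)
      ≤⟨ +-mono-≤ (≤-reflexive (length-upTo (suc (suc M)))) (length-concatMap-≤ window-at window-length ds) ⟩
    suc (suc M) + length ds * B                          ≡⟨ cong (λ n → suc (suc M) + n * B) (length-upTo (suc ⌊log₂ k ⌋)) ⟩
    suc (suc M) + suc ⌊log₂ k ⌋ * B                      ∎
    where
    open ≤-Reasoning
    ds : List ℕ
    ds = upTo (suc ⌊log₂ k ⌋)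
    B : ℕ
    B = suc (suc M + suc M)
    window-length : ∀ d → length (window-at d) ≤ B
    window-length d = length-window (suc M) ⌊ k /2^ d ⌋

cover-bound≤13ML : ∀ M L → 1 ≤ M → 1 ≤ L → suc (suc M) + suc L * suc (suc M + suc M) ≤ 13 * M * L
cover-bound≤13ML (suc m) (suc l) _ _ = begin
  bound                ≤⟨ m≤m+n bound slack ⟩
  bound + slack        ≡⟨ solve 2 (λ m l → (con 3 :+ m) :+ (con 2 :+ l) :* (con 1 :+ ((con 2 :+ m) :+ (con 2 :+ m)))
                                          :+ (con 11 :* l :* m :+ con 8 :* l :+ con 8 :* m)
                                        := con 13 :* (con 1 :+ m) :* (con 1 :+ l)) refl m l ⟩
  13 * suc m * suc l   ∎
  where
  open ≤-Reasoning
  bound slack : ℕ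
  bound = suc (suc (suc m)) + suc (suc l) * suc (suc (suc m) + suc (suc m))
  slack = 11 * l * m + 8 * l + 8 * m

lemma10 : ∃[ C ] ∀ (k M : ℕ) → 1 ≤ M → 2 ≤ k →
            card-F k M ≤ C * M * ⌊log₂ k ⌋
lemma10 = 13 , λ k M M≥1 k≥2 → begin
  card-F k M
    ≤⟨ unique∧⊆⇒length-≤ (deduplicate-! (F k M)) (F⊆cover k M ∘ ∈-deduplicate⁻ _≟_ (F k M)) ⟩
  length (cover k M)
    ≤⟨ length-cover k M ⟩
  suc (suc M) + suc ⌊log₂ k ⌋ * suc (suc M + suc M)
    ≤⟨ cover-bound≤13ML M ⌊log₂ k ⌋ M≥1 (⌊n/2^d⌋>0⇒d≤⌊log₂n⌋ 1 k (⌊n/2⌋-mono k≥2)) ⟩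
  13 * M * ⌊log₂ k ⌋
    ∎
  where open ≤-Reasoning
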